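{- Let $a_0\in\{0,1\}$, let $a_1,a_3,a_5,\dots$ (all odd-indexed $a_{2m+1}$, $m\ge 0$) be arbitrary real numbers, and let $b_i=(i+a_0)\bmod 2$ for $i\ge 0$ (so $b_0=a_0$, $b_{2m}=a_0$ and $b_{2m+1}=1-b_{2m}$). Let $t(i,j)$ be the zero-sum triangle (defined in the context) with left boundary $(a_i)$ and right boundary $(b_i)$, where the even-indexed left boundary values $a_{2m}$, $m\ge 1$, are determined recursively by $$a_{2m}=\begin{cases}\displaystyle\sum_{k=1}^{2m-1}t(2m,k)a_k & \text{if } a_0=0,\\[2mm] \displaystyle\sum_{k=0}^{2m-2}t(2m-1,k)a_{k+1} & \text{if } a_0=1\end{cases}$$ (the right-hand sides depend only on $a_1,\dots,a_{2m-1}$ and $b_0,\dots,b_{2m}$). For $n\ge1$ let $T_n$ be the $n\times n$ lower triangular matrix with $T_n(i+1,j+1)=t(i,j)$ for $0\le j\le i\le n-1$ and zeros above the diagonal. Then $T_n^2=T_n$ for every $n\ge 1$. Moreover, with $s_0(i)=\sum_{k=0}^{i}t(i,k)a_k$, $s_1(i)=\sum_{k=0}^{i}t(i,k)a_{k+1}$, $s_{ -1}(i)=\sum_{k=1}^{i}t(i,k)a_{k-1}$, one has $s_0(0)=a_0$, $s_1(0)=a_0a_1$, $s_{ -1}(1)=0$, and for all $i\ge 1$: $$s_0(i)=a_i,\qquad s_1(i)=a_0\{a_i+a_{i+1}\}-a_i,\qquad s_{ -1}(i)=0.$$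
   Context: Zero-sum triangle: given sequences $(a_i)_{i\ge0}$, $(b_i)_{i\ge0}$ with $b_0=a_0$, define numbers $t(i,j)$ for integers $0\le j\le i$ by $t(i,0)=a_i$ for $i\ge 0$, $t(i,i)=b_i$ for $i\ge 1$, and for $0<j<i$ by the zero-sum rule $t(i,j)+t(i-1,j-1)+t(i-1,j)=0$, i.e. $t(i,j)=-t(i-1,j-1)-t(i-1,j)$. -}

module Defs where

open import Algebra.Bundles using (CommutativeRing)
open import Data.Nat using (ℕ; zero; suc) renaming (_+_ to _+ℕ_)
open import Data.Nat using ( _∸_; _≡ᵇ_; _<ᵇ_; _≤ᵇ_)
open import Data.Nat.DivMod using (_%_; _/_)
open import Data.Bool using (Bool; true; false; if_then_else_)
open import Data.Fin using (Fin; toℕ)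

-- Parameters:
--   a0   : Bool     -- a₀ ∈ {0,1}  (false ↦ 0, true ↦ 1)
--   aOdd : ℕ → R    -- aOdd m = a_{2m+1}, arbitrary
module ZeroSum {c ℓ} (R : CommutativeRing c ℓ) (a0 : Bool)
               (aOdd : ℕ → CommutativeRing.Carrier R) where
  open CommutativeRing R

  bit : Bool → Carrier
  bit true  = 1#
  bit false = 0#

  a0ℕ : ℕ
  a0ℕ = if a0 then 1 else 0

  a0v : Carrier
  a0v = bit a0

  b : ℕ → Carrier
  b i = if ((i +ℕ a0ℕ) % 2) ≡ᵇ 0 then 0# else 1#

  ∑ : ℕ → (ℕ → Carrier) → Carrier
  ∑ zero    f = 0#
  ∑ (suc n) f = ∑ n f + f n

  -- A table holding rows 0..i of the triangle: tab r j = t(r,j) for r ≤ i.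
  Tab : Set c
  Tab = ℕ → ℕ → Carrier

  -- The value a_n for n ≥ 1, computed from the table of rows 0..n-1.
  -- Odd n = 2m+1 : a_n = aOdd m.
  -- Even n = 2m  : the recursive definition of the paper; here
  --   t(2m,k) for 1 ≤ k ≤ 2m-1 is the interior value -(t(2m-1,k-1)+t(2m-1,k))
  --   and a_k = t(k,0).
  aNext : Tab → ℕ → Carrier
  aNext tab n =
    if (n % 2) ≡ᵇ 1 then aOdd (n / 2)
    else (if a0
          then ∑ (n ∸ 1) (λ k → tab (n ∸ 1) k * tab (suc k) 0)
          else ∑ (n ∸ 1) (λ k →
                 (- (tab (n ∸ 1) k + tab (n ∸ 1) (suc k))) * tab (suc k) 0))

  newRow : ℕ → Carrier → Carrier → (ℕ → Carrier) → ℕ → Carrier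
  newRow n an bn prev zero    = an
  newRow n an bn prev (suc j) =
    if suc j <ᵇ n then - (prev j + prev (suc j))
    else (if suc j ≡ᵇ n then bn else 0#)

  row0 : ℕ → Carrier
  row0 zero    = a0v
  row0 (suc j) = 0#

  table : ℕ → Tab
  table zero    = λ _ j → row0 j
  table (suc n) = λ i j →
    if i ≡ᵇ suc n
    then newRow (suc n) (aNext (table n) (suc n)) (b (suc n)) (table n n) j
    else table n i j

  -- the zero-sum triangle t(i,j) (0 for j > i)
  t : ℕ → ℕ → Carrier
  t i j = table i i j

  a : ℕ → Carrier
  a i = t i 0

  T : (n : ℕ) → Fin n → Fin n → Carrier
  T n i j = if toℕ j ≤ᵇ toℕ i then t (toℕ i) (toℕ j) else 0#

  _⊗_ : {n : ℕ} → (Fin n → Fin n → Carrier) → (Fin n → Fin n → Carrier)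
        → Fin n → Fin n → Carrier
  _⊗_ {n} M N i j = sumFin n (λ k → M i k * N k j)
    where
    sumFin : (m : ℕ) → (Fin m → Carrier) → Carrier
    sumFin zero    f = 0#
    sumFin (suc m) f = f Fin.zero + sumFin m (λ k → f (Fin.suc k))

  s₀ : ℕ → Carrier
  s₀ i = ∑ (suc i) (λ k → t i k * a k)

  s₁ : ℕ → Carrier
  s₁ i = ∑ (suc i) (λ k → t i k * a (suc k))

  s₋₁ : ℕ → Carrier
  s₋₁ i = ∑ i (λ k → t i (suc k) * a k)

module Submission where

-- Write S f i = Σ_{k ≤ i} t(i,k) f_k.  Because b_i + b_{i+1} = 1, the zero-sum rule becomes the row
-- recursion  S f (i+1) = (a_{i+1} + a_i) f_0 + f_{i+1} − S f i − S (f ∘ suc) i,  valid for every f.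
-- Everything follows from s₀ = a, i.e. S a = a: the row recursion then yields s₁ and s₋₁, and,
-- applied to the columns of T, it yields Σ_k t(i,k) t(k,j) = t(i,j), which is T² = T.
-- S a = a is proved along i.  At even i it is the defining recursion of a_i.  At odd i one uses that,
-- for an arbitrary left boundary, the twisted defect d(i) = (−1)^i (S a i − a_i) has the shape
-- d = r₀ δ + W (r₁ δ + W (r₂ δ + …)), where W f = (0, 0, −f₀, −f₀−f₁, …) multiplies generating
-- functions by −x²/(1−x).  As W raises the order of vanishing by two, d(0) = … = d(2m) = 0 forces
-- d(2m+1) = 0.

open import Defs
open import Algebra.Bundles using (CommutativeRing)
open import Data.Bool using (Bool; true; false; if_then_else_)
open import Data.Fin as Fin using (Fin; toℕ)
import Data.Fin.Properties as FinP
open import Data.Integer as ℤ using (ℤ; +_; -[1+_]; _⊖_; 0ℤ; 1ℤ)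
import Data.Integer.Properties as ℤP
open import Data.List using (List; []; _∷_)
open import Data.Maybe using (Maybe; just; nothing)
open import Data.Nat as ℕ using (ℕ; zero; suc; _≤_; _<_; z≤n; s≤s; _≡ᵇ_; _<ᵇ_; _≤ᵇ_)
open import Data.Nat.DivMod using (_%_)
import Data.Nat.Properties as ℕP
open import Data.Product using (_×_; _,_; proj₁; proj₂)
import Data.Sign as Sign
open import Data.Sum using (_⊎_; inj₁; inj₂)
open import Level using (_⊔_)
open import Relation.Binary.Definitions using (tri<; tri≈; tri>)
import Relation.Binary.PropositionalEquality as P
open P using (_≡_)
open import Relation.Nullary using (yes; no)

≡ᵇ-refl : ∀ n → (n ≡ᵇ n) ≡ true
≡ᵇ-refl zero    = P.refl
≡ᵇ-refl (suc n) = ≡ᵇ-refl n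

<⇒≡ᵇ-false : ∀ {i n} → i < n → (i ≡ᵇ n) ≡ false
<⇒≡ᵇ-false {zero}  {suc n} _       = P.refl
<⇒≡ᵇ-false {suc i} {suc n} (s≤s p) = <⇒≡ᵇ-false p

>⇒≡ᵇ-false : ∀ {i n} → n < i → (i ≡ᵇ n) ≡ false
>⇒≡ᵇ-false {suc i} {zero}  _       = P.refl
>⇒≡ᵇ-false {suc i} {suc n} (s≤s p) = >⇒≡ᵇ-false p

<⇒<ᵇ-true : ∀ {i n} → i < n → (i <ᵇ n) ≡ true
<⇒<ᵇ-true {zero}  {suc n} _       = P.refl
<⇒<ᵇ-true {suc i} {suc n} (s≤s p) = <⇒<ᵇ-true p

≥⇒<ᵇ-false : ∀ {i n} → n ≤ i → (i <ᵇ n) ≡ false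
≥⇒<ᵇ-false {i}     {zero}  _       = P.refl
≥⇒<ᵇ-false {suc i} {suc n} (s≤s p) = ≥⇒<ᵇ-false p

<ᵇ-false⇒≥ : ∀ m n → (m <ᵇ n) ≡ false → n ≤ m
<ᵇ-false⇒≥ m       zero    _ = z≤n
<ᵇ-false⇒≥ (suc m) (suc n) e = s≤s (<ᵇ-false⇒≥ m n e)

≤ᵇ-false⇒> : ∀ m n → (m ≤ᵇ n) ≡ false → n < m
≤ᵇ-false⇒> (suc m) n e = s≤s (<ᵇ-false⇒≥ m n e)

true-or-false : ∀ x → x ≡ true ⊎ x ≡ false
true-or-false true  = inj₁ P.refl
true-or-false false = inj₂ P.refl

if-true : ∀ {a} {A : Set a} {x} {p q : A} → x ≡ true → (if x then p else q) ≡ p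
if-true P.refl = P.refl

if-false : ∀ {a} {A : Set a} {x} {p q : A} → x ≡ false → (if x then p else q) ≡ q
if-false P.refl = P.refl

double : ℕ → ℕ
double zero    = zero
double (suc m) = suc (suc (double m))

double-even : ∀ m → double m % 2 ≡ 0
double-even zero    = P.refl
double-even (suc m) = double-even m

n≤double : ∀ n → n ≤ double n
n≤double zero    = z≤n
n≤double (suc n) = s≤s (ℕP.m≤n⇒m≤1+n (n≤double n))

-- Ring solver with integer coefficients.  Coefficients from R itself would not do: their equality
-- is undecidable, so even x − x ≈ 0 could not be normalised.
module IntegerSolver {c ℓ} (R : CommutativeRing c ℓ) where
  open CommutativeRing R
  open import Algebra.Properties.Ring ring using (-‿involutive; -0#≈0#; -‿distribˡ-*; -‿distribʳ-*; -‿+-comm)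
  open import Algebra.Properties.Semiring.Mult.TCOptimised semiring
    using (×-homo-+; ×1-homo-*; 1+×) renaming (_×_ to _⊠_)
  open import Algebra.Solver.Ring.AlmostCommutativeRing
  open import Relation.Binary.Reasoning.Setoid setoid

  fromℤ : ℤ → Carrier
  fromℤ (+ n)    = n ⊠ 1#
  fromℤ -[1+ n ] = - (suc n ⊠ 1#)

  fromℤ-⊖ : ∀ m n → fromℤ (m ⊖ n) ≈ m ⊠ 1# + - (n ⊠ 1#)
  fromℤ-⊖ m       zero    = sym (trans (+-congˡ -0#≈0#) (+-identityʳ _))
  fromℤ-⊖ zero    (suc n) = sym (+-identityˡ _)
  fromℤ-⊖ (suc m) (suc n) = begin
    fromℤ (suc m ⊖ suc n)               ≡⟨ P.cong fromℤ (ℤP.[1+m]⊖[1+n]≡m⊖n m n) ⟩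
    fromℤ (m ⊖ n)                       ≈⟨ fromℤ-⊖ m n ⟩
    m ⊠ 1# + - (n ⊠ 1#)                 ≈⟨ +-congʳ (trans (+-congʳ (-‿inverseʳ 1#)) (+-identityˡ _)) ⟨
    ((1# + - 1#) + m ⊠ 1#) + - (n ⊠ 1#) ≈⟨ +-congʳ (+-assoc _ _ _) ⟩
    (1# + (- 1# + m ⊠ 1#)) + - (n ⊠ 1#) ≈⟨ +-congʳ (+-congˡ (+-comm _ _)) ⟩
    (1# + (m ⊠ 1# + - 1#)) + - (n ⊠ 1#) ≈⟨ +-congʳ (+-assoc _ _ _) ⟨
    ((1# + m ⊠ 1#) + - 1#) + - (n ⊠ 1#) ≈⟨ +-assoc _ _ _ ⟩
    (1# + m ⊠ 1#) + (- 1# + - (n ⊠ 1#)) ≈⟨ +-congˡ (-‿+-comm _ _) ⟩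
    (1# + m ⊠ 1#) + - (1# + n ⊠ 1#)     ≈⟨ +-cong (1+× m 1#) (-‿cong (1+× n 1#)) ⟨
    suc m ⊠ 1# + - (suc n ⊠ 1#)         ∎

  fromℤ-neg : ∀ i → fromℤ (ℤ.- i) ≈ - fromℤ i
  fromℤ-neg (+ zero)  = sym -0#≈0#
  fromℤ-neg (+ suc n) = refl
  fromℤ-neg -[1+ n ]  = sym (-‿involutive _)

  fromℤ-+ : ∀ i j → fromℤ (i ℤ.+ j) ≈ fromℤ i + fromℤ j
  fromℤ-+ -[1+ m ] -[1+ n ] = begin
    - (suc (suc (m ℕ.+ n)) ⊠ 1#)    ≡⟨ P.cong (λ k → - (suc k ⊠ 1#)) (P.sym (ℕP.+-suc m n)) ⟩
    - ((suc m ℕ.+ suc n) ⊠ 1#)      ≈⟨ -‿cong (×-homo-+ 1# (suc m) (suc n)) ⟩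
    - (suc m ⊠ 1# + suc n ⊠ 1#)     ≈⟨ -‿+-comm _ _ ⟨
    - (suc m ⊠ 1#) + - (suc n ⊠ 1#) ∎
  fromℤ-+ -[1+ m ] (+ n)    = trans (fromℤ-⊖ n (suc m)) (+-comm _ _)
  fromℤ-+ (+ m)    -[1+ n ] = fromℤ-⊖ m (suc n)
  fromℤ-+ (+ m)    (+ n)    = ×-homo-+ 1# m n

  signed : Sign.Sign → Carrier → Carrier
  signed Sign.+ x = x
  signed Sign.- x = - x

  fromℤ-◃ : ∀ s n → fromℤ (s ℤ.◃ n) ≈ signed s (n ⊠ 1#)
  fromℤ-◃ Sign.+ zero    = refl
  fromℤ-◃ Sign.- zero    = sym -0#≈0#
  fromℤ-◃ Sign.+ (suc n) = refl
  fromℤ-◃ Sign.- (suc n) = refl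

  fromℤ-signAbs : ∀ i → fromℤ i ≈ signed (ℤ.sign i) (ℤ.∣ i ∣ ⊠ 1#)
  fromℤ-signAbs (+ n)    = refl
  fromℤ-signAbs -[1+ n ] = refl

  signed-* : ∀ s t x y → signed (s Sign.* t) (x * y) ≈ signed s x * signed t y
  signed-* Sign.+ Sign.+ x y = refl
  signed-* Sign.+ Sign.- x y = -‿distribʳ-* x y
  signed-* Sign.- Sign.+ x y = -‿distribˡ-* x y
  signed-* Sign.- Sign.- x y = begin
    x * y       ≈⟨ -‿involutive _ ⟨
    - - (x * y) ≈⟨ -‿cong (-‿distribˡ-* x y) ⟩
    - (- x * y) ≈⟨ -‿distribʳ-* (- x) y ⟩
    - x * - y   ∎

  signed-cong : ∀ s {x y} → x ≈ y → signed s x ≈ signed s y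
  signed-cong Sign.+ x≈y = x≈y
  signed-cong Sign.- x≈y = -‿cong x≈y

  fromℤ-* : ∀ i j → fromℤ (i ℤ.* j) ≈ fromℤ i * fromℤ j
  fromℤ-* i j = begin
    fromℤ (i ℤ.* j)                                         ≈⟨ fromℤ-◃ (s Sign.* t) (ℤ.∣ i ∣ ℕ.* ℤ.∣ j ∣) ⟩
    signed (s Sign.* t) ((ℤ.∣ i ∣ ℕ.* ℤ.∣ j ∣) ⊠ 1#)      ≈⟨ signed-cong (s Sign.* t) (×1-homo-* ℤ.∣ i ∣ ℤ.∣ j ∣) ⟩
    signed (s Sign.* t) ((ℤ.∣ i ∣ ⊠ 1#) * (ℤ.∣ j ∣ ⊠ 1#)) ≈⟨ signed-* s t _ _ ⟩
    signed s (ℤ.∣ i ∣ ⊠ 1#) * signed t (ℤ.∣ j ∣ ⊠ 1#)    ≈⟨ *-cong (fromℤ-signAbs i) (fromℤ-signAbs j) ⟨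
    fromℤ i * fromℤ j                                       ∎
    where
    s t : Sign.Sign
    s = ℤ.sign i
    t = ℤ.sign j

  fromℤ-homo : CommutativeRing.rawRing ℤP.+-*-commutativeRing -Raw-AlmostCommutative⟶ fromCommutativeRing R
  fromℤ-homo = record
    { ⟦_⟧    = fromℤ
    ; +-homo = fromℤ-+
    ; *-homo = fromℤ-*
    ; -‿homo = fromℤ-neg
    ; 0-homo = refl
    ; 1-homo = refl
    }

  fromℤ-≟ : ∀ i j → Maybe (fromℤ i ≈ fromℤ j)
  fromℤ-≟ i j with i ℤ.≟ j
  ... | yes P.refl = just refl
  ... | no _       = nothing

  open import Algebra.Solver.Ring _ _ fromℤ-homo fromℤ-≟ public

module Sequences {c ℓ} (R : CommutativeRing c ℓ) where
  open CommutativeRing R hiding (zero)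
  open import Algebra.Properties.Ring ring using (-0#≈0#; -‿+-comm)
  open IntegerSolver R using (solve; _:+_; _:*_; :-_; _:=_; con)
  open import Relation.Binary.Reasoning.Setoid setoid

  Seq : Set c
  Seq = ℕ → Carrier

  infix 4 _≐_
  _≐_ : Seq → Seq → Set ℓ
  f ≐ g = ∀ i → f i ≈ g i

  sum : ℕ → Seq → Carrier
  sum zero    f = 0#
  sum (suc n) f = sum n f + f n

  sum-cong-< : ∀ n {f g} → (∀ k → k < n → f k ≈ g k) → sum n f ≈ sum n g
  sum-cong-< zero    h = refl
  sum-cong-< (suc n) h = +-cong (sum-cong-< n (λ k k<n → h k (ℕP.m<n⇒m<1+n k<n))) (h n ℕP.≤-refl)

  sum-cong : ∀ n {f g} → f ≐ g → sum n f ≈ sum n g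
  sum-cong n h = sum-cong-< n (λ k _ → h k)

  sum-+ : ∀ n f g → sum n (λ k → f k + g k) ≈ sum n f + sum n g
  sum-+ zero    f g = sym (+-identityʳ 0#)
  sum-+ (suc n) f g = begin
    sum n (λ k → f k + g k) + (f n + g n) ≈⟨ +-congʳ (sum-+ n f g) ⟩
    (sum n f + sum n g) + (f n + g n)     ≈⟨ solve 4 (λ a b c d → (a :+ b) :+ (c :+ d) := (a :+ c) :+ (b :+ d)) refl _ _ _ _ ⟩
    (sum n f + f n) + (sum n g + g n)     ∎

  sum-* : ∀ n r f → sum n (λ k → r * f k) ≈ r * sum n f
  sum-* zero    r f = sym (zeroʳ r)
  sum-* (suc n) r f = trans (+-congʳ (sum-* n r f)) (sym (distribˡ r _ _))

  sum-neg : ∀ n f → sum n (λ k → - f k) ≈ - sum n f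
  sum-neg zero    f = sym -0#≈0#
  sum-neg (suc n) f = trans (+-congʳ (sum-neg n f)) (-‿+-comm _ _)

  sum-zero : ∀ n → sum n (λ _ → 0#) ≈ 0#
  sum-zero zero    = refl
  sum-zero (suc n) = trans (+-identityʳ _) (sum-zero n)

  sum-suc : ∀ n f → sum (suc n) f ≈ f 0 + sum n (λ k → f (suc k))
  sum-suc zero    f = trans (+-identityˡ _) (sym (+-identityʳ _))
  sum-suc (suc n) f = trans (+-congʳ (sum-suc n f)) (+-assoc _ _ _)

  sum-truncate : ∀ {m} g → (∀ k → m ≤ k → g k ≈ 0#) → ∀ n → m ≤ n → sum n g ≈ sum m g
  sum-truncate g z zero    z≤n   = refl
  sum-truncate g z (suc n) m≤1+n with ℕP.m≤n⇒m<n∨m≡n m≤1+n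
  ... | inj₂ P.refl    = refl
  ... | inj₁ (s≤s m≤n) = trans (+-cong (sum-truncate g z n m≤n) (z n m≤n)) (+-identityʳ _)

  δ : Seq
  δ zero    = 1#
  δ (suc i) = 0#

  tail : Seq → Seq
  tail f i = f (suc i)

  shift : Seq → Seq
  shift f zero    = 0#
  shift f (suc i) = f i

  negSums : Seq → Seq
  negSums f i = - sum i f

  W : Seq → Seq
  W f i = shift f i + negSums f i

  sum-shift : ∀ n f → sum (suc n) (shift f) ≈ sum n f
  sum-shift zero    f = +-identityʳ 0#
  sum-shift (suc n) f = +-congʳ (sum-shift n f)

  head-decomposition : ∀ γ → γ ≐ (λ i → γ 0 * δ i + shift (tail γ) i)
  head-decomposition γ zero    = solve 1 (λ g → g := g :* con 1ℤ :+ con 0ℤ) refl (γ 0)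
  head-decomposition γ (suc i) = solve 2 (λ g h → h := g :* con 0ℤ :+ h) refl (γ 0) (γ (suc i))

  shift-negSums : ∀ f → shift (negSums f) ≐ W f
  shift-negSums f zero    = solve 0 (con 0ℤ := con 0ℤ :+ (:- con 0ℤ)) refl
  shift-negSums f (suc i) = solve 2 (λ s x → :- s := x :+ :- (s :+ x)) refl (sum i f) (f i)

  negSums-shift : ∀ f → negSums (shift f) ≐ shift (negSums f)
  negSums-shift f zero    = solve 0 (:- con 0ℤ := con 0ℤ) refl
  negSums-shift f (suc i) = -‿cong (sum-shift i f)

  W-zero : ∀ f → W f 0 ≈ 0#
  W-zero f = solve 0 (con 0ℤ :+ (:- con 0ℤ) := con 0ℤ) refl

  W-suc : ∀ f i → W f (suc i) ≈ - sum i f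
  W-suc f i = solve 2 (λ s x → x :+ :- (s :+ x) := :- s) refl (sum i f) (f i)

  shift-cong : ∀ {f g} → f ≐ g → shift f ≐ shift g
  shift-cong h zero    = refl
  shift-cong h (suc i) = h i

  negSums-cong : ∀ {f g} → f ≐ g → negSums f ≐ negSums g
  negSums-cong h i = -‿cong (sum-cong i h)

  -- Finite linear combinations Σ rₖ fₖ of sequences, kept symbolic so that the solver can treat
  -- shift fₖ and negSums fₖ as atoms.
  LinComb : Set c
  LinComb = List (Carrier × Seq)

  eval : LinComb → Seq
  eval []            i = 0#
  eval ((r , f) ∷ l) i = r * f i + eval l i

  eval-two : ∀ r f g i → r * f i + g i ≈ eval ((r , f) ∷ (1# , g) ∷ []) i
  eval-two r f g i = +-congˡ (sym (trans (+-identityʳ _) (*-identityˡ _)))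

  mapLC : (Seq → Seq) → LinComb → LinComb
  mapLC L []            = []
  mapLC L ((r , f) ∷ l) = (r , L f) ∷ mapLC L l

  record LinearOp : Set (c ⊔ ℓ) where
    field
      op      : Seq → Seq
      op-cong : ∀ {f g} → f ≐ g → op f ≐ op g
      op-lin  : ∀ r f g → op (λ i → r * f i + g i) ≐ (λ i → r * op f i + op g i)
      op-zero : op (λ _ → 0#) ≐ (λ _ → 0#)

    op-eval : ∀ l → op (eval l) ≐ eval (mapLC op l)
    op-eval []            = op-zero
    op-eval ((r , f) ∷ l) i = trans (op-lin r f (eval l) i) (+-congˡ (op-eval l i))

    op-≐eval : ∀ {f} l → f ≐ eval l → op f ≐ eval (mapLC op l)
    op-≐eval l h i = trans (op-cong h i) (op-eval l i)

  shiftLinear : LinearOp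
  shiftLinear = record
    { op      = shift
    ; op-cong = shift-cong
    ; op-lin  = λ { r f g zero    → solve 1 (λ r → con 0ℤ := r :* con 0ℤ :+ con 0ℤ) refl r
                  ; r f g (suc i) → refl }
    ; op-zero = λ { zero → refl ; (suc i) → refl }
    }

  negSumsLinear : LinearOp
  negSumsLinear = record
    { op      = negSums
    ; op-cong = negSums-cong
    ; op-lin  = λ r f g i → begin
        - sum i (λ k → r * f k + g k)       ≈⟨ -‿cong (sum-+ i _ _) ⟩
        - (sum i (λ k → r * f k) + sum i g) ≈⟨ -‿cong (+-congʳ (sum-* i r f)) ⟩
        - (r * sum i f + sum i g)           ≈⟨ solve 3 (λ r s t → :- (r :* s :+ t) := r :* (:- s) :+ (:- t)) refl r _ _ ⟩
        r * (- sum i f) + - sum i g         ∎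
    ; op-zero = λ i → trans (-‿cong (sum-zero i)) -0#≈0#
    }

  shift-eval : ∀ {f} l → f ≐ eval l → shift f ≐ eval (mapLC shift l)
  shift-eval = LinearOp.op-≐eval shiftLinear

  negSums-eval : ∀ {f} l → f ≐ eval l → negSums f ≐ eval (mapLC negSums l)
  negSums-eval = LinearOp.op-≐eval negSumsLinear

  W-linear : ∀ a u v → W (λ i → a * u i + v i) ≐ (λ i → a * W u i + W v i)
  W-linear a u v i =
    trans (+-cong (LinearOp.op-lin shiftLinear a u v i) (LinearOp.op-lin negSumsLinear a u v i))
          (solve 5 (λ a xu xv su sv → (a :* xu :+ xv) :+ (a :* su :+ sv) := a :* (xu :+ su) :+ (xv :+ sv))
                 refl a (shift u i) (shift v i) (negSums u i) (negSums v i))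

  -- The recursion determines F, since F φ i only involves F (tail φ) at indices below i.
  recursion-unique : (F G A B : Seq → Seq) →
    (∀ φ i → F φ i ≈ A φ i + negSums (λ k → F (tail φ) k + B φ k) i) →
    (∀ φ i → G φ i ≈ A φ i + negSums (λ k → G (tail φ) k + B φ k) i) →
    ∀ φ → F φ ≐ G φ
  recursion-unique F G A B hF hG φ i = below (suc i) φ i ℕP.≤-refl
    where
    below : ∀ n φ k → k < n → F φ k ≈ G φ k
    below (suc n) φ k k<1+n with ℕP.m<1+n⇒m<n∨m≡n k<1+n
    ... | inj₁ k<n    = below n φ k k<n
    ... | inj₂ P.refl = begin
      F φ k                                          ≈⟨ hF φ k ⟩
      A φ k + - sum k (λ j → F (tail φ) j + B φ j) ≈⟨ +-congˡ (-‿cong (sum-cong-< k (λ j j<k → +-congʳ (below k (tail φ) j j<k)))) ⟩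
      A φ k + - sum k (λ j → G (tail φ) j + B φ j) ≈⟨ hG φ k ⟨
      G φ k                                          ∎

module Expansions {c ℓ} (R : CommutativeRing c ℓ) where
  open CommutativeRing R hiding (zero)
  open import Algebra.Properties.Ring ring using (-0#≈0#; -‿distribˡ-*)
  open IntegerSolver R using (solve; _:+_; _:*_; _:-_; :-_; _:=_; con)
  open Sequences R
  open import Relation.Binary.Reasoning.Setoid setoid

  -- Φ φ β i = Σ_k u(i,k) φ_k for the triangle u(i,k) = u(i−1,k) − u(i−1,k−1) with left column β and
  -- zeros above the diagonal: the zero-sum triangle twisted by the signs (−1)^(i+k), except that its
  -- diagonal also follows the interior rule.  H supplies the correction for the true diagonal b.
  -- ΦS n φ β and HS n β are sum n (Φ φ β) and sum n (H β), unfolded for the termination checker.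
  mutual
    Φ : Seq → Seq → Seq
    Φ φ β i = φ 0 * β i - ΦS i (tail φ) β

    ΦS : ℕ → Seq → Seq → Carrier
    ΦS zero    φ β = 0#
    ΦS (suc n) φ β = ΦS n φ β + Φ φ β n

  mutual
    H : Seq → Seq
    H β i = β i - HS i (tail β)

    HS : ℕ → Seq → Carrier
    HS zero    β = 0#
    HS (suc n) β = HS n β + H β n

  ΦS≡sum : ∀ n φ β → ΦS n φ β ≡ sum n (Φ φ β)
  ΦS≡sum zero    φ β = P.refl
  ΦS≡sum (suc n) φ β = P.cong (_+ Φ φ β n) (ΦS≡sum n φ β)

  HS≡sum : ∀ n β → HS n β ≡ sum n (H β)
  HS≡sum zero    β = P.refl
  HS≡sum (suc n) β = P.cong (_+ H β n) (HS≡sum n β)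

  Φ-eq : ∀ φ β i → Φ φ β i ≈ φ 0 * β i + negSums (Φ (tail φ) β) i
  Φ-eq φ β i = reflexive (P.cong (λ s → φ 0 * β i - s) (ΦS≡sum i (tail φ) β))

  H-eq : ∀ β i → H β i ≈ β i + negSums (H (tail β)) i
  H-eq β i = reflexive (P.cong (λ s → β i - s) (HS≡sum i (tail β)))

  -- The recursions below write τ₀, τ₁, H and defect at β as r δ + W g, where g is a linear combination
  -- of δ and of these sequences at tail β and tail (tail β); hence all of them have expansions of any depth.
  τ₀ τ₁ τ : Seq → Seq
  τ₀ γ i = γ i + Φ γ δ i
  τ₁ γ i = shift γ i + negSums (Φ γ δ) i
  τ  γ i = γ 0 * δ i + (τ₁ (tail γ) i - τ₀ (tail γ) i)

  defect : Seq → Seq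
  defect β i = Φ β β i - negSums (H (tail β)) i - β i

  Φ-linear : ∀ r z φ → Φ φ (λ i → r * δ i + shift z i) ≐ (λ i → r * Φ φ δ i + shift (Φ φ z) i)
  Φ-linear r z = recursion-unique F G A B hF hG
    where
    β' : Seq
    β' i = r * δ i + shift z i
    F G A B : Seq → Seq
    F φ = Φ φ β'
    G φ i = r * Φ φ δ i + shift (Φ φ z) i
    A φ i = φ 0 * β' i
    B φ k = 0#
    hF : ∀ φ i → F φ i ≈ A φ i + negSums (λ k → F (tail φ) k + B φ k) i
    hF φ i = trans (Φ-eq φ β' i) (+-congˡ (negSums-cong (λ k → sym (+-identityʳ _)) i))
    hG : ∀ φ i → G φ i ≈ A φ i + negSums (λ k → G (tail φ) k + B φ k) i
    hG φ i = begin
      r * Φ φ δ i + shift (Φ φ z) i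
        ≈⟨ +-cong (*-congˡ (Φ-eq φ δ i)) (shift-eval ((φ 0 , z) ∷ (1# , negSums (Φ (tail φ) z)) ∷ [])
              (λ k → trans (Φ-eq φ z k) (eval-two (φ 0) z (negSums (Φ (tail φ) z)) k)) i) ⟩
      r * (φ 0 * δ i + negSums (Φ (tail φ) δ) i) + (φ 0 * shift z i + (1# * shift (negSums (Φ (tail φ) z)) i + 0#))
        ≈⟨ +-congˡ (+-congˡ (+-congʳ (*-congˡ (sym (negSums-shift _ i))))) ⟩
      r * (φ 0 * δ i + negSums (Φ (tail φ) δ) i) + (φ 0 * shift z i + (1# * negSums (shift (Φ (tail φ) z)) i + 0#))
        ≈⟨ solve 6 (λ r p d x s1 s2 → r :* (p :* d :+ s1) :+ (p :* x :+ (con 1ℤ :* s2 :+ con 0ℤ))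
                     := p :* (r :* d :+ x) :+ (r :* s1 :+ (con 1ℤ :* s2 :+ con 0ℤ))) refl
             r (φ 0) (δ i) (shift z i) (negSums (Φ (tail φ) δ) i) (negSums (shift (Φ (tail φ) z)) i) ⟩
      φ 0 * β' i + (r * negSums (Φ (tail φ) δ) i + (1# * negSums (shift (Φ (tail φ) z)) i + 0#))
        ≈⟨ +-congˡ (sym (negSums-eval ((r , Φ (tail φ) δ) ∷ (1# , shift (Φ (tail φ) z)) ∷ [])
              (λ k → solve 3 (λ r a b → (r :* a :+ b) :+ con 0ℤ := r :* a :+ (con 1ℤ :* b :+ con 0ℤ)) refl r _ _) i)) ⟩
      φ 0 * β' i + negSums (λ k → G (tail φ) k + 0#) i ∎

  Φ-cong₂ : ∀ {β β'} → β ≐ β' → ∀ φ → Φ φ β ≐ Φ φ β'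
  Φ-cong₂ {β} {β'} h = recursion-unique (λ φ → Φ φ β) (λ φ → Φ φ β') (λ φ i → φ 0 * β i) (λ _ _ → 0#)
    (λ φ i → trans (Φ-eq φ β i) (+-congˡ (negSums-cong (λ k → sym (+-identityʳ _)) i)))
    (λ φ i → trans (Φ-eq φ β' i) (+-cong (*-congˡ (sym (h i))) (negSums-cong (λ k → sym (+-identityʳ _)) i)))

  Φ-diag-recursion : ∀ β → Φ β β ≐ (λ i → (β 0 * β 0) * δ i + β 0 * τ₁ (tail β) i + W (Φ (tail β) (tail β)) i)
  Φ-diag-recursion β i = begin
    Φ β β i ≈⟨ Φ-eq β β i ⟩
    β 0 * β i + negSums (Φ (tail β) β) i
      ≈⟨ +-cong (*-congˡ (head-decomposition β i))
           (negSums-eval ((β 0 , Φ (tail β) δ) ∷ (1# , shift (Φ (tail β) (tail β))) ∷ [])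
              (λ k → trans (Φ-cong₂ (head-decomposition β) (tail β) k) (trans (Φ-linear (β 0) (tail β) (tail β) k)
                 (eval-two (β 0) (Φ (tail β) δ) (shift (Φ (tail β) (tail β))) k))) i) ⟩
    β 0 * (β 0 * δ i + shift (tail β) i) + (β 0 * negSums (Φ (tail β) δ) i + (1# * negSums (shift (Φ (tail β) (tail β))) i + 0#))
      ≈⟨ +-congˡ (+-congˡ (+-congʳ (*-congˡ (trans (negSums-shift _ i) (shift-negSums _ i))))) ⟩
    β 0 * (β 0 * δ i + shift (tail β) i) + (β 0 * negSums (Φ (tail β) δ) i + (1# * W (Φ (tail β) (tail β)) i + 0#))
      ≈⟨ solve 5 (λ b d x s w → b :* (b :* d :+ x) :+ (b :* s :+ (con 1ℤ :* w :+ con 0ℤ))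
                 := (b :* b) :* d :+ b :* (x :+ s) :+ w)
               refl (β 0) (δ i) (shift (tail β) i) (negSums (Φ (tail β) δ) i) (W (Φ (tail β) (tail β)) i) ⟩
    (β 0 * β 0) * δ i + β 0 * τ₁ (tail β) i + W (Φ (tail β) (tail β)) i ∎

  τ₀-recursion : ∀ γ → τ₀ γ ≐ (λ i → (γ 0 + γ 0) * δ i + τ₁ (tail γ) i)
  τ₀-recursion γ i = begin
    γ i + Φ γ δ i ≈⟨ +-cong (head-decomposition γ i) (Φ-eq γ δ i) ⟩
    (γ 0 * δ i + shift (tail γ) i) + (γ 0 * δ i + negSums (Φ (tail γ) δ) i)
      ≈⟨ solve 4 (λ g d x s → (g :* d :+ x) :+ (g :* d :+ s) := (g :+ g) :* d :+ (x :+ s)) refl (γ 0) (δ i) _ _ ⟩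
    (γ 0 + γ 0) * δ i + τ₁ (tail γ) i ∎

  τ₁-recursion : ∀ γ → τ₁ γ ≐ W (τ γ)
  τ₁-recursion γ i = begin
    shift γ i + negSums (Φ γ δ) i
      ≈⟨ +-cong (shift-eval ((γ 0 , δ) ∷ (1# , shift u) ∷ []) (λ k → trans (head-decomposition γ k) (eval-two (γ 0) δ (shift u) k)) i)
                (negSums-eval ((γ 0 , δ) ∷ (1# , negSums g) ∷ []) (λ k → trans (Φ-eq γ δ k) (eval-two (γ 0) δ (negSums g) k)) i) ⟩
    (γ 0 * shift δ i + (1# * shift (shift u) i + 0#)) + (γ 0 * negSums δ i + (1# * negSums (negSums g) i + 0#))
      ≈⟨ solve 9 (λ c xd sd xxu ssg xg sg xu su →
              (c :* xd :+ (con 1ℤ :* xxu :+ con 0ℤ)) :+ (c :* sd :+ (con 1ℤ :* ssg :+ con 0ℤ))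
              := (c :* xd :+ (con 1ℤ :* xxu :+ (con 1ℤ :* (xg :+ sg) :+ (:- con 1ℤ :* xu :+ (:- con 1ℤ :* xg :+ con 0ℤ)))))
               :+ (c :* sd :+ (con 1ℤ :* (xu :+ su) :+ (con 1ℤ :* ssg :+ (:- con 1ℤ :* su :+ (:- con 1ℤ :* sg :+ con 0ℤ))))))
            refl (γ 0) (shift δ i) (negSums δ i) (shift (shift u) i) (negSums (negSums g) i) (shift g i) (negSums g i) (shift u i) (negSums u i) ⟩
    (γ 0 * shift δ i + (1# * shift (shift u) i + (1# * (shift g i + negSums g i) + (- 1# * shift u i + (- 1# * shift g i + 0#)))))
      + (γ 0 * negSums δ i + (1# * (shift u i + negSums u i) + (1# * negSums (negSums g) i + (- 1# * negSums u i + (- 1# * negSums g i + 0#)))))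
      ≈⟨ +-cong (+-congˡ (+-congˡ (+-congʳ (*-congˡ (sym (shift-negSums g i))))))
                (+-congˡ (+-congʳ (*-congˡ (sym (trans (negSums-shift u i) (shift-negSums u i)))))) ⟩
    eval (mapLC shift l) i + eval (mapLC negSums l) i
      ≈⟨ +-cong (sym (shift-eval l τ≐eval i)) (sym (negSums-eval l τ≐eval i)) ⟩
    W (τ γ) i ∎
    where
    u g : Seq
    u = tail γ
    g = Φ (tail γ) δ
    l : LinComb
    l = (γ 0 , δ) ∷ (1# , shift u) ∷ (1# , negSums g) ∷ (- 1# , u) ∷ (- 1# , g) ∷ []
    τ≐eval : τ γ ≐ eval l
    τ≐eval k = solve 6 (λ c d xu sg uu gg → c :* d :+ ((xu :+ sg) :- (uu :+ gg))
                 := c :* d :+ (con 1ℤ :* xu :+ (con 1ℤ :* sg :+ (:- con 1ℤ :* uu :+ (:- con 1ℤ :* gg :+ con 0ℤ)))))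
                 refl (γ 0) (δ k) (shift u k) (negSums g k) (u k) (g k)

  negSums-H : ∀ β i → negSums (H β) i ≈ negSums β i + negSums (negSums (H (tail β))) i
  negSums-H β i = trans (negSums-eval ((1# , β) ∷ (1# , negSums (H (tail β))) ∷ [])
                     (λ k → trans (H-eq β k) (solve 2 (λ a b → a :+ b := con 1ℤ :* a :+ (con 1ℤ :* b :+ con 0ℤ)) refl _ _)) i)
                  (solve 2 (λ a b → con 1ℤ :* a :+ (con 1ℤ :* b :+ con 0ℤ) := a :+ b) refl _ _)

  H-recursion : ∀ β → H β ≐ (λ i → β 0 * δ i + W (λ k → H (tail β) k - H (tail (tail β)) k) i)
  H-recursion β i = begin
    H β i ≈⟨ H-eq β i ⟩
    β i + negSums (H (tail β)) i ≈⟨ +-cong (head-decomposition β i) (negSums-H (tail β) i) ⟩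
    (β 0 * δ i + shift b1 i) + (negSums b1 i + negSums (negSums H2) i)
      ≈⟨ solve 7 (λ b d xb sb ssh xh sh → (b :* d :+ xb) :+ (sb :+ ssh)
            := b :* d :+ ((con 1ℤ :* xb :+ (con 1ℤ :* (xh :+ sh) :+ (:- con 1ℤ :* xh :+ con 0ℤ)))
                         :+ (con 1ℤ :* sb :+ (con 1ℤ :* ssh :+ (:- con 1ℤ :* sh :+ con 0ℤ)))))
           refl (β 0) (δ i) (shift b1 i) (negSums b1 i) (negSums (negSums H2) i) (shift H2 i) (negSums H2 i) ⟩
    β 0 * δ i + ((1# * shift b1 i + (1# * (shift H2 i + negSums H2 i) + (- 1# * shift H2 i + 0#)))
                 + (1# * negSums b1 i + (1# * negSums (negSums H2) i + (- 1# * negSums H2 i + 0#))))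
      ≈⟨ +-congˡ (+-congʳ (+-congˡ (+-congʳ (*-congˡ (sym (shift-negSums H2 i)))))) ⟩
    β 0 * δ i + (eval (mapLC shift l) i + eval (mapLC negSums l) i)
      ≈⟨ +-congˡ (+-cong (sym (shift-eval l inner≐eval i)) (sym (negSums-eval l inner≐eval i))) ⟩
    β 0 * δ i + W (λ k → H (tail β) k - H (tail (tail β)) k) i ∎
    where
    b1 H2 : Seq
    b1 = tail β
    H2 = H (tail (tail β))
    l : LinComb
    l = (1# , b1) ∷ (1# , negSums H2) ∷ (- 1# , H2) ∷ []
    inner≐eval : (λ k → H (tail β) k - H (tail (tail β)) k) ≐ eval l
    inner≐eval k = trans (+-congʳ (H-eq b1 k))
      (solve 3 (λ a b c → (a :+ b) :- c := con 1ℤ :* a :+ (con 1ℤ :* b :+ (:- con 1ℤ :* c :+ con 0ℤ))) refl (b1 k) (negSums H2 k) (H2 k))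

  defect-recursion : ∀ β → defect β ≐ (λ i → (β 0 * β 0 - β 0) * δ i + β 0 * τ₁ (tail β) i
                                              + W (λ k → defect (tail β) k + H (tail (tail β)) k) i)
  defect-recursion β i = begin
    Φ β β i - negSums (H (tail β)) i - β i
      ≈⟨ +-cong (+-cong (Φ-diag-recursion β i) (-‿cong (negSums-H (tail β) i))) (-‿cong (head-decomposition β i)) ⟩
    ((β 0 * β 0) * δ i + β 0 * τ₁ (tail β) i + (shift ΦΦ i + negSums ΦΦ i)) - (negSums b1 i + negSums (negSums H2) i) - (β 0 * δ i + shift b1 i)
      ≈⟨ solve 10 (λ b d t xf sf sb ssh xb xh sh →
            ((b :* b) :* d :+ b :* t :+ (xf :+ sf)) :- (sb :+ ssh) :- (b :* d :+ xb)
            := (b :* b :- b) :* d :+ b :* t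
               :+ ((con 1ℤ :* xf :+ (:- con 1ℤ :* (xh :+ sh) :+ (:- con 1ℤ :* xb :+ (con 1ℤ :* xh :+ con 0ℤ))))
                   :+ (con 1ℤ :* sf :+ (:- con 1ℤ :* ssh :+ (:- con 1ℤ :* sb :+ (con 1ℤ :* sh :+ con 0ℤ))))))
          refl (β 0) (δ i) (τ₁ (tail β) i) (shift ΦΦ i) (negSums ΦΦ i) (negSums b1 i) (negSums (negSums H2) i)
               (shift b1 i) (shift H2 i) (negSums H2 i) ⟩
    (β 0 * β 0 - β 0) * δ i + β 0 * τ₁ (tail β) i
      + ((1# * shift ΦΦ i + (- 1# * (shift H2 i + negSums H2 i) + (- 1# * shift b1 i + (1# * shift H2 i + 0#))))
         + (1# * negSums ΦΦ i + (- 1# * negSums (negSums H2) i + (- 1# * negSums b1 i + (1# * negSums H2 i + 0#)))))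
      ≈⟨ +-congˡ (+-congʳ (+-congˡ (+-congʳ (*-congˡ (sym (shift-negSums H2 i)))))) ⟩
    (β 0 * β 0 - β 0) * δ i + β 0 * τ₁ (tail β) i + (eval (mapLC shift l) i + eval (mapLC negSums l) i)
      ≈⟨ +-congˡ (+-cong (sym (shift-eval l inner≐eval i)) (sym (negSums-eval l inner≐eval i))) ⟩
    (β 0 * β 0 - β 0) * δ i + β 0 * τ₁ (tail β) i + W (λ k → defect (tail β) k + H (tail (tail β)) k) i ∎
    where
    b1 H2 ΦΦ : Seq
    b1 = tail β
    H2 = H (tail (tail β))
    ΦΦ = Φ (tail β) (tail β)
    l : LinComb
    l = (1# , ΦΦ) ∷ (- 1# , negSums H2) ∷ (- 1# , b1) ∷ (1# , H2) ∷ []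
    inner≐eval : (λ k → defect (tail β) k + H (tail (tail β)) k) ≐ eval l
    inner≐eval k = solve 4 (λ f s b h → ((f :- s) :- b) :+ h
              := con 1ℤ :* f :+ (:- con 1ℤ :* s :+ (:- con 1ℤ :* b :+ (con 1ℤ :* h :+ con 0ℤ)))) refl (ΦΦ k) (negSums H2 k) (b1 k) (H2 k)

  data Expansion : ℕ → Seq → Set (c ⊔ ℓ) where
    done : ∀ {f} → Expansion zero f
    step : ∀ {n f} r g → f ≐ (λ i → r * δ i + W g i) → Expansion n g → Expansion (suc n) f

  expansion-cong : ∀ {n f f′} → f ≐ f′ → Expansion n f → Expansion n f′
  expansion-cong h done            = done
  expansion-cong h (step r g e eg) = step r g (λ i → trans (sym (h i)) (e i)) eg

  expansion-linear : ∀ {n f g} a → Expansion n f → Expansion n g → Expansion n (λ i → a * f i + g i)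
  expansion-linear a done done = done
  expansion-linear {f = f} {g} a (step r u e eu) (step s v e′ ev) =
    step (a * r + s) (λ i → a * u i + v i) decomposition (expansion-linear a eu ev)
    where
    decomposition : ∀ i → a * f i + g i ≈ (a * r + s) * δ i + W (λ k → a * u k + v k) i
    decomposition i = begin
      a * f i + g i                               ≈⟨ +-cong (*-congˡ (e i)) (e′ i) ⟩
      a * (r * δ i + W u i) + (s * δ i + W v i) ≈⟨ solve 6 (λ a r d wu s wv → a :* (r :* d :+ wu) :+ (s :* d :+ wv)
                                                            := (a :* r :+ s) :* d :+ (a :* wu :+ wv)) refl a r (δ i) (W u i) s (W v i) ⟩
      (a * r + s) * δ i + (a * W u i + W v i)     ≈⟨ +-congˡ (W-linear a u v i) ⟨
      (a * r + s) * δ i + W (λ k → a * u k + v k) i ∎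

  W-of-zero : W (λ _ → 0#) ≐ (λ _ → 0#)
  W-of-zero i = trans (+-cong (LinearOp.op-zero shiftLinear i) (LinearOp.op-zero negSumsLinear i)) (+-identityʳ 0#)

  expansion-zero : ∀ n → Expansion n (λ _ → 0#)
  expansion-zero zero    = done
  expansion-zero (suc n) =
    step 0# (λ _ → 0#) (λ i → sym (trans (+-cong (zeroˡ _) (W-of-zero i)) (+-identityʳ 0#))) (expansion-zero n)

  expansion-δ : ∀ n r → Expansion n (λ i → r * δ i)
  expansion-δ zero    r = done
  expansion-δ (suc n) r =
    step r (λ _ → 0#) (λ i → sym (trans (+-congˡ (W-of-zero i)) (+-identityʳ _))) (expansion-zero n)

  expansion-+ : ∀ {n f g} → Expansion n f → Expansion n g → Expansion n (λ i → f i + g i)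
  expansion-+ ef eg = expansion-cong (λ i → +-congʳ (*-identityˡ _)) (expansion-linear 1# ef eg)

  expansion-sub : ∀ {n f g} → Expansion n f → Expansion n g → Expansion n (λ i → f i - g i)
  expansion-sub {n} ef eg =
    expansion-+ ef (expansion-cong (λ i → trans (+-identityʳ _) (trans (sym (-‿distribˡ-* 1# _)) (-‿cong (*-identityˡ _))))
                                   (expansion-linear (- 1#) eg (expansion-zero n)))

  expansion-τ₀τ₁ : ∀ n γ → Expansion n (τ₀ γ) × Expansion n (τ₁ γ)
  expansion-τ : ∀ n γ → Expansion n (τ γ)

  expansion-τ₀τ₁ zero    γ = done , done
  expansion-τ₀τ₁ (suc n) γ =
      step (γ 0 + γ 0) (τ (tail γ)) (λ i → trans (τ₀-recursion γ i) (+-congˡ (τ₁-recursion (tail γ) i))) (expansion-τ n (tail γ))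
    , step 0# (τ γ) (λ i → trans (τ₁-recursion γ i) (sym (trans (+-congʳ (zeroˡ _)) (+-identityˡ _)))) (expansion-τ n γ)

  expansion-τ n γ =
    expansion-+ (expansion-δ n (γ 0)) (expansion-sub (proj₂ (expansion-τ₀τ₁ n (tail γ))) (proj₁ (expansion-τ₀τ₁ n (tail γ))))

  expansion-H : ∀ n β → Expansion n (H β)
  expansion-H zero    β = done
  expansion-H (suc n) β = step (β 0) _ (H-recursion β) (expansion-sub (expansion-H n (tail β)) (expansion-H n (tail (tail β))))

  expansion-defect : ∀ n β → Expansion n (defect β)
  expansion-defect zero    β = done
  expansion-defect (suc n) β =
    step (β 0 * β 0 - β 0) (λ i → β 0 * τ (tail β) i + (defect (tail β) i + H (tail (tail β)) i))
      (λ i → trans (defect-recursion β i)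
               (trans (+-assoc _ _ _) (+-congˡ (trans (+-congʳ (*-congˡ (τ₁-recursion (tail β) i))) (sym (W-linear (β 0) _ _ i))))))
      (expansion-linear (β 0) (expansion-τ n (tail β)) (expansion-+ (expansion-defect n (tail β)) (expansion-H n (tail (tail β)))))

  VanishesBelow : ℕ → Seq → Set ℓ
  VanishesBelow n f = ∀ i → i < n → f i ≈ 0#

  sum-vanishing : ∀ {n f} → VanishesBelow n f → ∀ i → i ≤ n → sum i f ≈ 0#
  sum-vanishing v zero    _    = refl
  sum-vanishing v (suc i) i<n = trans (+-cong (sum-vanishing v i (ℕP.<⇒≤ i<n)) (v i i<n)) (+-identityʳ 0#)

  W-vanishing : ∀ {n g} → VanishesBelow n g → VanishesBelow (2 ℕ.+ n) (W g)
  W-vanishing {g = g} v zero    _           = W-zero g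
  W-vanishing {g = g} v (suc i) (s≤s i<1+n) = trans (W-suc g i) (trans (-‿cong (sum-vanishing v i (ℕP.≤-pred i<1+n))) -0#≈0#)

  W-vanishing⁻¹ : ∀ {n g} → VanishesBelow (2 ℕ.+ n) (W g) → VanishesBelow n g
  W-vanishing⁻¹ {g = g} v k k<n = begin
    g k                                 ≈⟨ solve 2 (λ s x → x := :- s :- (:- (s :+ x))) refl (sum k g) (g k) ⟩
    - sum k g - - sum (suc k) g         ≈⟨ +-cong (sym (W-suc g k)) (-‿cong (sym (W-suc g (suc k)))) ⟩
    W g (suc k) - W g (suc (suc k))     ≈⟨ +-cong (v (suc k) (s≤s (ℕP.m<n⇒m<1+n k<n))) (-‿cong (v (suc (suc k)) (s≤s (s≤s k<n)))) ⟩
    0# - 0#                             ≈⟨ -‿inverseʳ 0# ⟩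
    0#                                  ∎

  drop-δ : ∀ {f r g} → f ≐ (λ i → r * δ i + W g i) → f 0 ≈ 0# → f ≐ W g
  drop-δ {f} {r} {g} e f0≈0 i = trans (e i) (trans (+-congʳ (trans (*-congʳ r≈0) (zeroˡ _))) (+-identityˡ _))
    where
    r≈0 : r ≈ 0#
    r≈0 = begin
      r              ≈⟨ trans (+-cong (*-identityʳ r) (W-zero g)) (+-identityʳ r) ⟨
      r * 1# + W g 0 ≈⟨ e 0 ⟨
      f 0            ≈⟨ f0≈0 ⟩
      0#             ∎

  vanishing-≐ : ∀ {n f g} → f ≐ g → VanishesBelow n g → VanishesBelow n f
  vanishing-≐ f≐g v i i<n = trans (f≐g i) (v i i<n)

  -- W raises the order of vanishing by two, so vanishing up to 2m forces r₀ = … = r_m = 0.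
  expansion-vanishing : ∀ m {f} → Expansion (suc m) f →
                        VanishesBelow (suc (double m)) f → VanishesBelow (suc (suc (double m))) f
  expansion-vanishing zero    (step r g e _) v =
    vanishing-≐ (drop-δ e (v 0 (s≤s z≤n))) (W-vanishing {n = 0} (λ _ ()))
  expansion-vanishing (suc m) (step r g e eg) v =
    vanishing-≐ f≐Wg (W-vanishing (expansion-vanishing m eg (W-vanishing⁻¹ (vanishing-≐ (λ i → sym (f≐Wg i)) v))))
    where
    f≐Wg = drop-δ e (v 0 (s≤s z≤n))

module Triangle {c ℓ} (R : CommutativeRing c ℓ) (a0 : Bool) (aOdd : ℕ → CommutativeRing.Carrier R) where
  open CommutativeRing R hiding (zero)
  open ZeroSum R a0 aOdd
  open IntegerSolver R using (solve; _:+_; _:*_; _:-_; :-_; _:=_; con)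
  open Sequences R
  open Expansions R using (Φ; Φ-eq; H; negSums-H; defect; expansion-defect; expansion-vanishing)
  open import Algebra.Properties.Monoid.Sum +-monoid using () renaming (sum to ∑ᶠ)
  open import Relation.Binary.Reasoning.Setoid setoid

  ∑≡sum : ∀ n f → ∑ n f ≡ sum n f
  ∑≡sum zero    f = P.refl
  ∑≡sum (suc n) f = P.cong (_+ f n) (∑≡sum n f)

  table-stable : ∀ n i j → i ≤ n → table n i j ≡ t i j
  table-stable zero    zero j z≤n = P.refl
  table-stable (suc n) i    j i≤1+n with ℕP.m≤n⇒m<n∨m≡n i≤1+n
  ... | inj₂ P.refl = P.refl
  ... | inj₁ (s≤s i≤n) rewrite <⇒≡ᵇ-false (s≤s i≤n) = table-stable n i j i≤n

  t-row : ∀ n j → t (suc n) j ≡ newRow (suc n) (aNext (table n) (suc n)) (b (suc n)) (t n) j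
  t-row n j rewrite ≡ᵇ-refl n = P.refl

  t-interior : ∀ {n j} → j < n → t (suc n) (suc j) ≡ - (t n j + t n (suc j))
  t-interior {n} {j} j<n rewrite t-row n (suc j) | <⇒<ᵇ-true j<n = P.refl

  t-diag-suc : ∀ n → t (suc n) (suc n) ≡ b (suc n)
  t-diag-suc n rewrite t-row n (suc n) | ≥⇒<ᵇ-false (ℕP.≤-refl {n}) | ≡ᵇ-refl n = P.refl

  t-above-suc : ∀ {n j} → n < j → t (suc n) (suc j) ≡ 0#
  t-above-suc {n} {j} n<j rewrite t-row n (suc j) | ≥⇒<ᵇ-false (ℕP.<⇒≤ n<j) | >⇒≡ᵇ-false n<j = P.refl

  t-above : ∀ {i j} → i < j → t i j ≈ 0#
  t-above {zero}  {suc j} _         = refl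
  t-above {suc i} {suc j} (s≤s i<j) = reflexive (t-above-suc i<j)

  parity : ∀ p → (((p % 2) ≡ᵇ 0) ≡ true × ((suc p % 2) ≡ᵇ 0) ≡ false)
               ⊎ (((p % 2) ≡ᵇ 0) ≡ false × ((suc p % 2) ≡ᵇ 0) ≡ true)
  parity zero          = inj₁ (P.refl , P.refl)
  parity (suc zero)    = inj₂ (P.refl , P.refl)
  parity (suc (suc p)) = parity p

  b+b-suc : ∀ i → b i + b (suc i) ≈ 1#
  b+b-suc i with parity (i ℕ.+ a0ℕ)
  ... | inj₁ (even , odd) rewrite even | odd = +-identityˡ 1#
  ... | inj₂ (odd , even) rewrite odd | even = +-identityʳ 1#

  b-suc : ∀ i → b (suc i) ≈ 1# - b i
  b-suc i = begin
    b (suc i)               ≈⟨ solve 2 (λ x y → y := (x :+ y) :- x) refl (b i) (b (suc i)) ⟩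
    (b i + b (suc i)) - b i ≈⟨ +-congʳ (b+b-suc i) ⟩
    1# - b i                ∎

  b-zero : b 0 ≡ a0v
  b-zero = b-zero′ a0
    where
    b-zero′ : ∀ x → (if ((if x then 1 else 0) % 2) ≡ᵇ 0 then 0# else 1#) ≡ bit x
    b-zero′ true  = P.refl
    b-zero′ false = P.refl

  b-double : ∀ m → b (double m) ≈ a0v
  b-double zero    = reflexive b-zero
  b-double (suc m) = b-double m

  a0v-idem : a0v * a0v ≈ a0v
  a0v-idem = bit-idem a0
    where
    bit-idem : ∀ x → bit x * bit x ≈ bit x
    bit-idem true  = *-identityˡ 1#
    bit-idem false = zeroˡ 0#

  t-diag : ∀ i → t i i ≈ b i
  t-diag zero    = reflexive (P.sym b-zero)
  t-diag (suc i) = reflexive (t-diag-suc i)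

  t-diag-step : ∀ i → t (suc i) (suc i) ≈ 1# - t i i
  t-diag-step i = trans (reflexive (t-diag-suc i)) (trans (b-suc i) (+-congˡ (-‿cong (sym (t-diag i)))))

  sgn : ℕ → Carrier
  sgn zero    = 1#
  sgn (suc i) = - sgn i

  sgn² : ∀ i → sgn i * sgn i ≈ 1#
  sgn² zero    = *-identityˡ 1#
  sgn² (suc i) = trans (solve 1 (λ s → (:- s) :* (:- s) := s :* s) refl (sgn i)) (sgn² i)

  S : Seq → ℕ → Carrier
  S f i = sum (suc i) (λ k → t i k * f k)

  S-cong : ∀ {f g} i → (∀ k → k ≤ i → f k ≈ g k) → S f i ≈ S g i
  S-cong i h = sum-cong-< (suc i) (λ k k< → *-congˡ (h k (ℕP.≤-pred k<)))

  S-lin : ∀ r f g i → S (λ k → r * f k + g k) i ≈ r * S f i + S g i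
  S-lin r f g i = begin
    sum (suc i) (λ k → t i k * (r * f k + g k))
      ≈⟨ sum-cong (suc i) (λ k → solve 4 (λ t r f g → t :* (r :* f :+ g) := r :* (t :* f) :+ t :* g) refl (t i k) r (f k) (g k)) ⟩
    sum (suc i) (λ k → r * (t i k * f k) + t i k * g k) ≈⟨ sum-+ (suc i) _ _ ⟩
    sum (suc i) (λ k → r * (t i k * f k)) + S g i ≈⟨ +-congʳ (sum-* (suc i) r _) ⟩
    r * S f i + S g i ∎

  S-suc : ∀ f i → S f (suc i) ≈ (a (suc i) + a i) * f 0 + f (suc i) - S f i - S (tail f) i
  S-suc f i = begin
    S f (suc i) ≈⟨ sum-suc (suc i) _ ⟩
    a (suc i) * f 0 + (sum i (λ k → t (suc i) (suc k) * f (suc k)) + t (suc i) (suc i) * f (suc i))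
      ≈⟨ +-congˡ (+-cong (sum-cong-< i (λ k k<i → *-congʳ (reflexive (t-interior k<i)))) (*-congʳ (t-diag-step i))) ⟩
    a (suc i) * f 0 + (sum i (λ k → - (t i k + t i (suc k)) * f (suc k)) + (1# - t i i) * f (suc i))
      ≈⟨ +-congˡ (+-congʳ (sum-cong i (λ k → solve 3 (λ x y z → (:- (x :+ y)) :* z := (:- con 1ℤ) :* (x :* z) :+ (:- (y :* z)))
                                                       refl (t i k) (t i (suc k)) (f (suc k))))) ⟩
    a (suc i) * f 0 + (sum i (λ k → (- 1#) * (t i k * f (suc k)) + (- (t i (suc k) * f (suc k)))) + (1# - t i i) * f (suc i))
      ≈⟨ +-congˡ (+-congʳ (trans (sum-+ i _ _) (+-cong (sum-* i (- 1#) _) (sum-neg i _)))) ⟩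
    a (suc i) * f 0 + (((- 1#) * P + - Q) + (1# - t i i) * f (suc i))
      ≈⟨ solve 7 (λ a1 a0 f0 fs p q tii →
              a1 :* f0 :+ ((((:- con 1ℤ) :* p) :+ (:- q)) :+ (con 1ℤ :- tii) :* fs)
              := (a1 :+ a0) :* f0 :+ fs :- (a0 :* f0 :+ q) :- (p :+ tii :* fs))
           refl (a (suc i)) (a i) (f 0) (f (suc i)) P Q (t i i) ⟩
    (a (suc i) + a i) * f 0 + f (suc i) - (a i * f 0 + Q) - (P + t i i * f (suc i))
      ≈⟨ +-congʳ (+-congˡ (-‿cong (sym (sum-suc i (λ k → t i k * f k))))) ⟩
    (a (suc i) + a i) * f 0 + f (suc i) - S f i - S (tail f) i ∎
    where
    P Q : Carrier
    P = sum i (λ k → t i k * f (suc k))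
    Q = sum i (λ k → t i (suc k) * f (suc k))

  S-neg : ∀ g i → S (λ k → - g k) i ≈ - S g i
  S-neg g i = trans (sum-cong (suc i) (λ k → solve 2 (λ t g → t :* (:- g) := :- (t :* g)) refl (t i k) (g k))) (sum-neg (suc i) _)

  unit : ℕ → Seq
  unit m k = if k ≡ᵇ m then 1# else 0#

  sum-unit-ge : ∀ i m n → n ≤ m → sum n (λ k → t i k * unit m k) ≈ 0#
  sum-unit-ge i m zero    _  = refl
  sum-unit-ge i m (suc n) le rewrite <⇒≡ᵇ-false {n} {m} le =
    trans (+-cong (sum-unit-ge i m n (ℕP.<⇒≤ le)) (zeroʳ _)) (+-identityʳ 0#)

  sum-unit-lt : ∀ i m n → m < n → sum n (λ k → t i k * unit m k) ≈ t i m
  sum-unit-lt i m (suc n) lt with ℕP.m<1+n⇒m<n∨m≡n lt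
  ... | inj₂ P.refl rewrite ≡ᵇ-refl m = trans (+-cong (sum-unit-ge i m m ℕP.≤-refl) (*-identityʳ _)) (+-identityˡ _)
  ... | inj₁ m<n rewrite >⇒≡ᵇ-false m<n = trans (+-cong (sum-unit-lt i m n m<n) (zeroʳ _)) (+-identityʳ _)

  S-unit : ∀ m i → S (unit m) i ≈ t i m
  S-unit m i with ℕP.≤-<-connex m i
  ... | inj₁ m≤i = sum-unit-lt i m (suc i) (s≤s m≤i)
  ... | inj₂ i<m = trans (sum-unit-ge i m (suc i) i<m) (sym (t-above i<m))

  unit-refl : ∀ j → unit j j ≡ 1#
  unit-refl j rewrite ≡ᵇ-refl j = P.refl

  column-suc : ∀ j k → t (suc k) (suc j) ≈ (- 1#) * t k j + ((- 1#) * t k (suc j) + unit j k)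
  column-suc j k with ℕP.<-cmp j k
  ... | tri< j<k _ _ rewrite >⇒≡ᵇ-false j<k =
    trans (reflexive (t-interior j<k)) (solve 2 (λ x y → :- (x :+ y) := (:- con 1ℤ) :* x :+ ((:- con 1ℤ) :* y :+ con 0ℤ)) refl (t k j) (t k (suc j)))
  ... | tri≈ _ P.refl _ = begin
    t (suc j) (suc j) ≈⟨ t-diag-step j ⟩
    1# - t j j ≈⟨ solve 1 (λ x → con 1ℤ :- x := (:- con 1ℤ) :* x :+ ((:- con 1ℤ) :* con 0ℤ :+ con 1ℤ)) refl (t j j) ⟩
    (- 1#) * t j j + ((- 1#) * 0# + 1#) ≈⟨ +-congˡ (+-congʳ (*-congˡ (sym (t-above (ℕP.n<1+n j))))) ⟩
    (- 1#) * t j j + ((- 1#) * t j (suc j) + 1#) ≈⟨ +-congˡ (+-congˡ (reflexive (P.sym (unit-refl j)))) ⟩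
    (- 1#) * t j j + ((- 1#) * t j (suc j) + unit j j) ∎
  ... | tri> _ _ k<j rewrite <⇒≡ᵇ-false k<j =
    trans (reflexive (t-above-suc k<j))
      (trans (solve 0 (con 0ℤ := (:- con 1ℤ) :* con 0ℤ :+ ((:- con 1ℤ) :* con 0ℤ :+ con 0ℤ)) refl)
        (+-cong (*-congˡ (sym (t-above k<j))) (+-congʳ (*-congˡ (sym (t-above (ℕP.m<n⇒m<1+n k<j)))))))

  S-column : (∀ i → S a i ≈ a i) → ∀ i j → S (λ k → t k j) i ≈ t i j
  S-column h zero    zero    = h 0
  S-column h zero    (suc j) = trans (+-congˡ (zeroʳ _)) (+-identityʳ 0#)
  S-column h (suc i) zero    = h (suc i)
  S-column h (suc i) (suc j) = begin
    S cj (suc i) ≈⟨ S-suc cj i ⟩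
    (a (suc i) + a i) * 0# + t (suc i) (suc j) - S cj i - S (tail cj) i
      ≈⟨ +-cong (+-congˡ (-‿cong (S-column h i (suc j)))) (-‿cong S-tail-column) ⟩
    (a (suc i) + a i) * 0# + t (suc i) (suc j) - t i (suc j) - ((- 1#) * t i j + ((- 1#) * t i (suc j) + t i j))
      ≈⟨ solve 4 (λ x y p q → x :* con 0ℤ :+ y :- p :- ((:- con 1ℤ) :* q :+ ((:- con 1ℤ) :* p :+ q)) := y)
               refl (a (suc i) + a i) (t (suc i) (suc j)) (t i (suc j)) (t i j) ⟩
    t (suc i) (suc j) ∎
    where
    cj : Seq
    cj k = t k (suc j)
    S-tail-column : S (tail cj) i ≈ (- 1#) * t i j + ((- 1#) * t i (suc j) + t i j)
    S-tail-column = begin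
      S (tail cj) i ≈⟨ S-cong i (λ k _ → column-suc j k) ⟩
      S (λ k → (- 1#) * t k j + ((- 1#) * t k (suc j) + unit j k)) i ≈⟨ S-lin (- 1#) _ _ i ⟩
      (- 1#) * S (λ k → t k j) i + S (λ k → (- 1#) * t k (suc j) + unit j k) i ≈⟨ +-congˡ (S-lin (- 1#) _ _ i) ⟩
      (- 1#) * S (λ k → t k j) i + ((- 1#) * S cj i + S (unit j) i)
        ≈⟨ +-cong (*-congˡ (S-column h i j)) (+-cong (*-congˡ (S-column h i (suc j))) (S-unit j i)) ⟩
      (- 1#) * t i j + ((- 1#) * t i (suc j) + t i j) ∎

  α : Seq
  α i = sgn i * a i

  Ŝ : Seq → Seq
  Ŝ φ i = sgn i * S (λ k → sgn k * φ k) i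

  Ŝ-suc : ∀ φ i → Ŝ φ (suc i) ≈ Ŝ φ i + φ 0 * (α (suc i) - α i) - Ŝ (tail φ) i + φ (suc i)
  Ŝ-suc φ i = begin
    - s * S f (suc i) ≈⟨ *-congˡ (S-suc f i) ⟩
    - s * ((a (suc i) + a i) * f 0 + f (suc i) - S f i - S (tail f) i)
      ≈⟨ *-congˡ (+-congˡ (-‿cong S-tail-f)) ⟩
    - s * ((a (suc i) + a i) * (1# * φ 0) + (- s * φ (suc i)) - S f i - - S f⁺ i)
      ≈⟨ solve 7 (λ s a1 a0 p0 p1 sf u →
            (:- s) :* ((a1 :+ a0) :* (con 1ℤ :* p0) :+ ((:- s) :* p1) :- sf :- (:- u))
            := s :* sf :+ p0 :* (((:- s) :* a1) :- s :* a0) :- s :* u :+ (s :* s) :* p1)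
          refl s (a (suc i)) (a i) (φ 0) (φ (suc i)) (S f i) (S f⁺ i) ⟩
    s * S f i + φ 0 * ((- s * a (suc i)) - s * a i) - s * S f⁺ i + (s * s) * φ (suc i)
      ≈⟨ +-congˡ (trans (*-congʳ (sgn² i)) (*-identityˡ _)) ⟩
    Ŝ φ i + φ 0 * (α (suc i) - α i) - Ŝ (tail φ) i + φ (suc i) ∎
    where
    s : Carrier
    s = sgn i
    f f⁺ : Seq
    f k = sgn k * φ k
    f⁺ k = sgn k * φ (suc k)
    S-tail-f : S (tail f) i ≈ - S f⁺ i
    S-tail-f = trans (S-cong i (λ k _ → solve 2 (λ s p → (:- s) :* p := :- (s :* p)) refl (sgn k) (φ (suc k)))) (S-neg f⁺ i)

  Ŝ-recursion : ∀ φ i → Ŝ φ i ≈ φ 0 * α i + negSums (λ k → Ŝ (tail φ) k + - tail φ k) i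
  Ŝ-recursion φ zero    =
    solve 2 (λ p a00 → con 1ℤ :* (con 0ℤ :+ a00 :* (con 1ℤ :* p)) := p :* (con 1ℤ :* a00) :+ (:- con 0ℤ)) refl (φ 0) (t 0 0)
  Ŝ-recursion φ (suc i) = begin
    Ŝ φ (suc i) ≈⟨ Ŝ-suc φ i ⟩
    Ŝ φ i + φ 0 * (α (suc i) - α i) - Ŝ (tail φ) i + φ (suc i) ≈⟨ +-congʳ (+-congʳ (+-congʳ (Ŝ-recursion φ i))) ⟩
    (φ 0 * α i + - sum i g) + φ 0 * (α (suc i) - α i) - Ŝ (tail φ) i + φ (suc i)
      ≈⟨ solve 6 (λ p ai ai1 u x y → (p :* ai :+ (:- u)) :+ p :* (ai1 :- ai) :- x :+ y := p :* ai1 :+ (:- (u :+ (x :+ (:- y))))) refl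
           (φ 0) (α i) (α (suc i)) (sum i g) (Ŝ (tail φ) i) (φ (suc i)) ⟩
    φ 0 * α (suc i) + negSums g (suc i) ∎
    where
    g : Seq
    g k = Ŝ (tail φ) k + - tail φ k

  G : Seq → Seq
  G φ i = Φ φ α i - negSums (H (tail φ)) i

  G-recursion : ∀ φ i → G φ i ≈ φ 0 * α i + negSums (λ k → G (tail φ) k + - tail φ k) i
  G-recursion φ i = begin
    Φ φ α i - negSums (H (tail φ)) i ≈⟨ +-cong (Φ-eq φ α i) (-‿cong (negSums-H (tail φ) i)) ⟩
    (φ 0 * α i + negSums (Φ (tail φ) α) i) - (negSums (tail φ) i + negSums (negSums H2) i)
      ≈⟨ solve 4 (λ x sΦ sφ ssH → (x :+ sΦ) :- (sφ :+ ssH)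
                                 := x :+ (con 1ℤ :* sΦ :+ ((:- con 1ℤ) :* ssH :+ ((:- con 1ℤ) :* sφ :+ con 0ℤ)))) refl
           (φ 0 * α i) (negSums (Φ (tail φ) α) i) (negSums (tail φ) i) (negSums (negSums H2) i) ⟩
    φ 0 * α i + eval (mapLC negSums l) i ≈⟨ +-congˡ (sym (negSums-eval l inner≐eval i)) ⟩
    φ 0 * α i + negSums (λ k → G (tail φ) k + - tail φ k) i ∎
    where
    H2 : Seq
    H2 = H (tail (tail φ))
    l : LinComb
    l = (1# , Φ (tail φ) α) ∷ ((- 1#) , negSums H2) ∷ ((- 1#) , tail φ) ∷ []
    inner≐eval : (λ k → G (tail φ) k + - tail φ k) ≐ eval l
    inner≐eval k = solve 3 (λ x y z → (x :- y) :+ (:- z) := con 1ℤ :* x :+ ((:- con 1ℤ) :* y :+ ((:- con 1ℤ) :* z :+ con 0ℤ))) refl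
              (Φ (tail φ) α k) (negSums H2 k) (tail φ k)

  Ŝ≐G : ∀ φ → Ŝ φ ≐ G φ
  Ŝ≐G = recursion-unique Ŝ G (λ φ i → φ 0 * α i) (λ φ k → - tail φ k) Ŝ-recursion G-recursion

  defect-α : ∀ i → defect α i ≈ sgn i * (S a i - a i)
  defect-α i = begin
    G α i - α i ≈⟨ +-congʳ (sym (Ŝ≐G α i)) ⟩
    sgn i * S (λ k → sgn k * α k) i - α i
      ≈⟨ +-congʳ (*-congˡ (S-cong i (λ k _ → trans (trans (sym (*-assoc _ _ _)) (*-congʳ (sgn² k))) (*-identityˡ _)))) ⟩
    sgn i * S a i - sgn i * a i ≈⟨ solve 3 (λ s x y → s :* x :- s :* y := s :* (x :- y)) refl (sgn i) (S a i) (a i) ⟩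
    sgn i * (S a i - a i) ∎

  fixed⇒defect-zero : ∀ i → S a i ≈ a i → defect α i ≈ 0#
  fixed⇒defect-zero i h = trans (defect-α i) (trans (*-congˡ (trans (+-congʳ h) (-‿inverseʳ _))) (zeroʳ _))

  defect-zero⇒fixed : ∀ i → defect α i ≈ 0# → S a i ≈ a i
  defect-zero⇒fixed i h = begin
    S a i                                 ≈⟨ solve 2 (λ x y → x := (x :- y) :+ y) refl (S a i) (a i) ⟩
    (S a i - a i) + a i                   ≈⟨ +-congʳ (trans (sym (*-identityˡ _)) (*-congʳ (sym (sgn² i)))) ⟩
    (sgn i * sgn i) * (S a i - a i) + a i ≈⟨ +-congʳ (trans (*-assoc _ _ _) (*-congˡ (sym (defect-α i)))) ⟩
    sgn i * defect α i + a i              ≈⟨ +-congʳ (trans (*-congˡ h) (zeroʳ _)) ⟩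
    0# + a i                              ≈⟨ +-identityˡ _ ⟩
    a i                                   ∎

  FixedBelow : ℕ → Set ℓ
  FixedBelow n = ∀ i → i < n → S a i ≈ a i

  fixed-below-suc : ∀ {n} → FixedBelow n → S a n ≈ a n → FixedBelow (suc n)
  fixed-below-suc h hn i i<1+n with ℕP.m<1+n⇒m<n∨m≡n i<1+n
  ... | inj₁ i<n    = h i i<n
  ... | inj₂ P.refl = hn

  S-zero : S a 0 ≈ a 0
  S-zero = trans (+-identityˡ _) a0v-idem

  S-odd : ∀ m → FixedBelow (suc (double m)) → S a (suc (double m)) ≈ a (suc (double m))
  S-odd m h = defect-zero⇒fixed (suc (double m))
    (expansion-vanishing m (expansion-defect (suc m) α) (λ i i<n → fixed⇒defect-zero i (h i i<n)) (suc (double m)) ℕP.≤-refl)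

  aNext-even : ∀ tab m → aNext tab (suc (suc (double m))) ≡
    (if a0 then ∑ (suc (double m)) (λ k → tab (suc (double m)) k * tab (suc k) 0)
           else ∑ (suc (double m)) (λ k → (- (tab (suc (double m)) k + tab (suc (double m)) (suc k))) * tab (suc k) 0))
  aNext-even tab m rewrite double-even m = P.refl

  -- Case a₀ = 1: the definition gives a_{n+1} = s₁(n) − t(n,n) a_{n+1}, with t(n,n) = 1 − a₀ = 0.
  S-even-true : ∀ m → a0 ≡ true → S a (suc (double m)) ≈ a (suc (double m)) →
                S a (suc (suc (double m))) ≈ a (suc (suc (double m)))
  S-even-true m a0≡1 h = begin
    S a (suc n)                                                    ≈⟨ S-suc a n ⟩
    (a (suc n) + a n) * a 0 + a (suc n) - S a n - S (tail a) n     ≈⟨ +-cong (+-cong (+-congʳ (*-congˡ a0v≈1)) (-‿cong h)) (-‿cong S-tail-a) ⟩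
    (a (suc n) + a n) * 1# + a (suc n) - a n - a (suc n)           ≈⟨ solve 2 (λ x y → (x :+ y) :* con 1ℤ :+ x :- y :- x := x) refl (a (suc n)) (a n) ⟩
    a (suc n)                                                      ∎
    where
    n : ℕ
    n = suc (double m)
    a0v≈1 : a0v ≈ 1#
    a0v≈1 = reflexive (P.cong bit a0≡1)
    a-def : a (suc n) ≈ sum n (λ k → t n k * a (suc k))
    a-def = trans (reflexive (P.trans (t-row (suc (double m)) 0)
                              (P.trans (aNext-even (table n) m)
                              (P.trans (if-true a0≡1) (∑≡sum n _)))))
                  (sum-cong-< n (λ k k<n → *-congˡ (reflexive (table-stable n (suc k) 0 k<n))))
    S-tail-a : S (tail a) n ≈ a (suc n)
    S-tail-a = begin
      sum n (λ k → t n k * a (suc k)) + t n n * a (suc n)    ≈⟨ +-cong (sym a-def) (*-congʳ (t-diag-step (double m))) ⟩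
      a (suc n) + (1# - t (double m) (double m)) * a (suc n) ≈⟨ +-congˡ (*-congʳ (+-congˡ (-‿cong t-diag≈1))) ⟩
      a (suc n) + (1# - 1#) * a (suc n)                      ≈⟨ solve 1 (λ x → x :+ (con 1ℤ :- con 1ℤ) :* x := x) refl (a (suc n)) ⟩
      a (suc n)                                              ∎
      where
      t-diag≈1 : t (double m) (double m) ≈ 1#
      t-diag≈1 = trans (t-diag (double m)) (trans (b-double m) a0v≈1)

  -- Case a₀ = 0: the definition of a_{n+1} is s₀(n+1) minus its terms at k = 0 and k = n + 1, which vanish.
  S-even-false : ∀ m → a0 ≡ false → S a (suc (suc (double m))) ≈ a (suc (suc (double m)))
  S-even-false m a0≡0 = begin
    S a (suc n) ≈⟨ sum-suc (suc n) _ ⟩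
    a (suc n) * a 0 + (sum n (λ k → t (suc n) (suc k) * a (suc k)) + t (suc n) (suc n) * a (suc n))
      ≈⟨ +-cong (*-congˡ a0v≈0) (+-cong (sum-cong-< n (λ k k<n → *-congʳ (reflexive (t-interior k<n))))
                                         (*-congʳ (trans (t-diag (suc n)) (trans (b-double (suc m)) a0v≈0)))) ⟩
    a (suc n) * 0# + (sum n (λ k → - (t n k + t n (suc k)) * a (suc k)) + 0# * a (suc n))
      ≈⟨ +-congˡ (+-congʳ (sym a-def)) ⟩
    a (suc n) * 0# + (a (suc n) + 0# * a (suc n)) ≈⟨ solve 1 (λ x → x :* con 0ℤ :+ (x :+ con 0ℤ :* x) := x) refl (a (suc n)) ⟩
    a (suc n) ∎
    where
    n : ℕ
    n = suc (double m)
    a0v≈0 : a0v ≈ 0#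
    a0v≈0 = reflexive (P.cong bit a0≡0)
    a-def : a (suc n) ≈ sum n (λ k → - (t n k + t n (suc k)) * a (suc k))
    a-def = trans (reflexive (P.trans (t-row (suc (double m)) 0)
                              (P.trans (aNext-even (table n) m)
                              (P.trans (if-false a0≡0) (∑≡sum n _)))))
                  (sum-cong-< n (λ k k<n → *-congˡ (reflexive (table-stable n (suc k) 0 k<n))))

  S-even : ∀ m → S a (suc (double m)) ≈ a (suc (double m)) → S a (suc (suc (double m))) ≈ a (suc (suc (double m)))
  S-even m h with true-or-false a0
  ... | inj₁ a0≡1 = S-even-true m a0≡1 h
  ... | inj₂ a0≡0 = S-even-false m a0≡0

  fixed-below-odd : ∀ m → FixedBelow (suc (double m))
  fixed-below-odd zero    = fixed-below-suc (λ _ ()) S-zero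
  fixed-below-odd (suc m) = fixed-below-suc up-to-odd (S-even m (up-to-odd _ ℕP.≤-refl))
    where
    up-to-odd : FixedBelow (suc (suc (double m)))
    up-to-odd = fixed-below-suc (fixed-below-odd m) (S-odd m (fixed-below-odd m))

  S-a≈a : ∀ i → S a i ≈ a i
  S-a≈a i = fixed-below-odd i i (s≤s (n≤double i))

  ⊗≈∑ᶠ : ∀ n (M N : Fin n → Fin n → Carrier) i j → (M ⊗ N) i j ≈ ∑ᶠ (λ k → M i k * N k j)
  ⊗≈∑ᶠ (suc zero)    M N i j = refl
  ⊗≈∑ᶠ (suc (suc n)) M N i j =
    +-congˡ (⊗≈∑ᶠ (suc n) (λ _ k → M i (Fin.suc k)) (λ k _ → N (Fin.suc k) j) Fin.zero Fin.zero)

  ∑ᶠ≈sum : ∀ n (f : Fin n → Carrier) (g : ℕ → Carrier) → (∀ k → f k ≈ g (toℕ k)) → ∑ᶠ f ≈ sum n g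
  ∑ᶠ≈sum zero    f g f≈g = refl
  ∑ᶠ≈sum (suc n) f g f≈g =
    trans (+-cong (f≈g Fin.zero) (∑ᶠ≈sum n (λ k → f (Fin.suc k)) (λ k → g (suc k)) (λ k → f≈g (Fin.suc k)))) (sym (sum-suc n g))

  T≈t : ∀ n (i j : Fin n) → T n i j ≈ t (toℕ i) (toℕ j)
  T≈t n i j with toℕ j ≤ᵇ toℕ i in j≤ᵇi
  ... | true  = refl
  ... | false = sym (t-above (≤ᵇ-false⇒> (toℕ j) (toℕ i) j≤ᵇi))

  T-idempotent : ∀ n → 1 ≤ n → ∀ (i j : Fin n) → (T n ⊗ T n) i j ≈ T n i j
  T-idempotent n _ i j = begin
    (T n ⊗ T n) i j                          ≈⟨ ⊗≈∑ᶠ n (T n) (T n) i j ⟩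
    ∑ᶠ (λ k → T n i k * T n k j)             ≈⟨ ∑ᶠ≈sum n _ _ (λ k → *-cong (T≈t n i k) (T≈t n k j)) ⟩
    sum n (λ k → t (toℕ i) k * t k (toℕ j))  ≈⟨ sum-truncate _ (λ k i<k → trans (*-congʳ (t-above i<k)) (zeroˡ _)) n (FinP.toℕ<n i) ⟩
    S (λ k → t k (toℕ j)) (toℕ i)            ≈⟨ S-column S-a≈a (toℕ i) (toℕ j) ⟩
    t (toℕ i) (toℕ j)                        ≈⟨ T≈t n i j ⟨
    T n i j                                  ∎

  s₀≈a : ∀ i → s₀ i ≈ a i
  s₀≈a i = trans (reflexive (∑≡sum (suc i) _)) (S-a≈a i)

  s₁-formula : ∀ i → s₁ i ≈ a0v * (a i + a (suc i)) - a i
  s₁-formula i = begin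
    s₁ i            ≈⟨ reflexive (∑≡sum (suc i) _) ⟩
    S (tail a) i    ≈⟨ solve 4 (λ x ai1 ai a0 → x := (ai1 :+ ai) :* a0 :+ ai1 :- ai :- ((ai1 :+ ai) :* a0 :+ ai1 :- ai :- x))
                               refl (S (tail a) i) (a (suc i)) (a i) a0v ⟩
    (a (suc i) + a i) * a0v + a (suc i) - a i - ((a (suc i) + a i) * a0v + a (suc i) - a i - S (tail a) i)
                    ≈⟨ +-congˡ (-‿cong (trans (sym (+-congʳ (+-congˡ (-‿cong (S-a≈a i))))) (trans (sym (S-suc a i)) (S-a≈a (suc i))))) ⟩
    (a (suc i) + a i) * a0v + a (suc i) - a i - a (suc i)
                    ≈⟨ solve 3 (λ x y z → (x :+ y) :* z :+ x :- y :- x := z :* (y :+ x) :- y) refl (a (suc i)) (a i) a0v ⟩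
    a0v * (a i + a (suc i)) - a i ∎

  s₁-zero : s₁ 0 ≈ a0v * a 1
  s₁-zero = begin
    s₁ 0                                    ≈⟨ s₁-formula 0 ⟩
    a0v * (a0v + a 1) - a0v                 ≈⟨ solve 2 (λ x y → x :* (x :+ y) :- x := (x :* x :- x) :+ x :* y) refl a0v (a 1) ⟩
    (a0v * a0v - a0v) + a0v * a 1           ≈⟨ +-congʳ (trans (+-congʳ a0v-idem) (-‿inverseʳ _)) ⟩
    0# + a0v * a 1                          ≈⟨ +-identityˡ _ ⟩
    a0v * a 1                               ∎

  s₋₁≈0 : ∀ i → s₋₁ i ≈ 0#
  s₋₁≈0 zero    = refl
  s₋₁≈0 (suc i) = begin
    s₋₁ (suc i) ≈⟨ reflexive (∑≡sum (suc i) _) ⟩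
    sum i (λ k → t (suc i) (suc k) * a k) + t (suc i) (suc i) * a i
      ≈⟨ +-cong (sum-cong-< i (λ k k<i → *-congʳ (reflexive (t-interior k<i)))) (*-congʳ (t-diag-step i)) ⟩
    sum i (λ k → - (t i k + t i (suc k)) * a k) + (1# - t i i) * a i
      ≈⟨ +-congʳ (trans (sum-cong i (λ k → solve 3 (λ x y z → (:- (x :+ y)) :* z := (:- (x :* z)) :+ (:- (y :* z))) refl (t i k) (t i (suc k)) (a k)))
                        (trans (sum-+ i _ _) (+-cong (sum-neg i _) (sum-neg i _)))) ⟩
    (- sum i (λ k → t i k * a k) + - s) + (1# - t i i) * a i
      ≈⟨ solve 4 (λ p q tt ai → ((:- p) :+ (:- q)) :+ (con 1ℤ :- tt) :* ai := ai :- (p :+ tt :* ai) :- q)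
               refl (sum i (λ k → t i k * a k)) s (t i i) (a i) ⟩
    a i - S a i - s
      ≈⟨ +-cong (trans (+-congˡ (-‿cong (S-a≈a i))) (-‿inverseʳ _)) (-‿cong (trans (reflexive (P.sym (∑≡sum i _))) (s₋₁≈0 i))) ⟩
    0# - 0#     ≈⟨ -‿inverseʳ 0# ⟩
    0#          ∎
    where
    s : Carrier
    s = sum i (λ k → t i (suc k) * a k)

theorem1 : ∀ {c ℓ} (R : CommutativeRing c ℓ) (a0 : Bool)
             (aOdd : ℕ → CommutativeRing.Carrier R) →
           let open CommutativeRing R
               open ZeroSum R a0 aOdd
           in (∀ (n : ℕ) → 1 ≤ n → ∀ (i j : Fin n) → (T n ⊗ T n) i j ≈ T n i j)
              × (s₀ 0 ≈ a0v)
              × (s₁ 0 ≈ a0v * a 1)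
              × (s₋₁ 1 ≈ 0#)
              × (∀ (i : ℕ) → 1 ≤ i →
                   (s₀ i ≈ a i)
                   × (s₁ i ≈ a0v * (a i + a (suc i)) - a i)
                   × (s₋₁ i ≈ 0#))
theorem1 R a0 aOdd =
    T-idempotent
  , s₀≈a 0
  , s₁-zero
  , s₋₁≈0 1
  , λ i _ → s₀≈a i , s₁-formula i , s₋₁≈0 i
  where open Triangle R a0 aOdd
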